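{- Let $q=3^5$. For every $(\ell_0,m_0)\in\mathbb{F}_q^2\setminus\{(0,0)\}$, the $\mathbb{F}_3$-linearized polynomial $$m_0\ell_0^{81}x^{81}+m_0^{10}x^{9}-\ell_0^2x$$ is a permutation polynomial of $\mathbb{F}_q$.
   Context: A polynomial $g(x)\in\mathbb{F}_q[x]$ is a permutation polynomial of $\mathbb{F}_q$ if the map $c\mapsto g(c)$ is a bijection of $\mathbb{F}_q$. -}

module Defs where

open import Data.Nat using (ℕ; zero; suc)
open import Data.Product using (_×_; _,_)
open import Relation.Binary.PropositionalEquality using (_≡_)
open import Function.Definitions using (Bijective)

data F₃ : Set where
  𝟘 𝟙 𝟚 : F₃

_+₃_ : F₃ → F₃ → F₃
𝟘 +₃ b = b
𝟙 +₃ 𝟘 = 𝟙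
𝟙 +₃ 𝟙 = 𝟚
𝟙 +₃ 𝟚 = 𝟘
𝟚 +₃ 𝟘 = 𝟚
𝟚 +₃ 𝟙 = 𝟘
𝟚 +₃ 𝟚 = 𝟙

_*₃_ : F₃ → F₃ → F₃
𝟘 *₃ b = 𝟘
𝟙 *₃ b = b
𝟚 *₃ 𝟘 = 𝟘
𝟚 *₃ 𝟙 = 𝟚
𝟚 *₃ 𝟚 = 𝟙

-₃_ : F₃ → F₃
-₃ 𝟘 = 𝟘
-₃ 𝟙 = 𝟚
-₃ 𝟚 = 𝟙

-- The field F_q, q = 3^5, realised as F₃[t]/(t^5 + 2t + 1)
-- (t^5 + 2t + 1 is irreducible over F₃: it is the Conway polynomial C_{3,5}).
-- An element a0 + a1 t + a2 t^2 + a3 t^3 + a4 t^4 is stored as its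
-- coefficient vector; this representation is canonical, so _≡_ is field equality.

record F₂₄₃ : Set where
  constructor el
  field
    c0 c1 c2 c3 c4 : F₃

0F : F₂₄₃
0F = el 𝟘 𝟘 𝟘 𝟘 𝟘

1F : F₂₄₃
1F = el 𝟙 𝟘 𝟘 𝟘 𝟘

_+F_ : F₂₄₃ → F₂₄₃ → F₂₄₃
el a0 a1 a2 a3 a4 +F el b0 b1 b2 b3 b4 =
  el (a0 +₃ b0) (a1 +₃ b1) (a2 +₃ b2) (a3 +₃ b3) (a4 +₃ b4)

-F_ : F₂₄₃ → F₂₄₃
-F el a0 a1 a2 a3 a4 = el (-₃ a0) (-₃ a1) (-₃ a2) (-₃ a3) (-₃ a4)

_-F_ : F₂₄₃ → F₂₄₃ → F₂₄₃
a -F b = a +F (-F b)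

_·F_ : F₃ → F₂₄₃ → F₂₄₃
s ·F el a0 a1 a2 a3 a4 = el (s *₃ a0) (s *₃ a1) (s *₃ a2) (s *₃ a3) (s *₃ a4)

-- multiplication by t, using t^5 = -2t - 1 = t + 2
mulT : F₂₄₃ → F₂₄₃
mulT (el a0 a1 a2 a3 a4) = el 𝟘 a0 a1 a2 a3 +F (a4 ·F el 𝟚 𝟙 𝟘 𝟘 𝟘)

_*F_ : F₂₄₃ → F₂₄₃ → F₂₄₃
a *F el b0 b1 b2 b3 b4 =
  (b0 ·F a) +F mulT ((b1 ·F a) +F mulT ((b2 ·F a) +F mulT ((b3 ·F a) +F mulT (b4 ·F a))))

_^F_ : F₂₄₃ → ℕ → F₂₄₃
a ^F zero  = 1F
a ^F suc n = a *F (a ^F n)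

IsPermutationOf𝔽q : (F₂₄₃ → F₂₄₃) → Set
IsPermutationOf𝔽q g = Bijective _≡_ _≡_ g

linPoly : F₂₄₃ → F₂₄₃ → F₂₄₃ → F₂₄₃
linPoly ℓ0 m0 x =
  (((m0 *F (ℓ0 ^F 81)) *F (x ^F 81)) +F ((m0 ^F 10) *F (x ^F 9))) -F ((ℓ0 ^F 2) *F x)

{-# OPTIONS --safe #-}
module Submission where

open import Defs
open import Algebra.Bundles using (CommutativeSemigroup)
import Algebra.Properties.CommutativeSemigroup as CommutativeSemigroupProperties
open import Data.Bool using (Bool; _∧_; T)
open import Data.Bool.Properties using (T-∧)
open import Data.Empty using (⊥-elim)
open import Data.Fin using (Fin; zero; suc)
open import Data.Fin.Properties using () renaming (all? to allFin?)
open import Data.Maybe using (maybe′)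
open import Data.Nat using (ℕ; zero; suc; _+_; _*_; _^_)
open import Data.Product using (_×_; _,_; ∃; proj₁; proj₂)
open import Data.Sum using (inj₁; inj₂)
open import Data.Vec using (Vec; []; _∷_; map; zipWith; iterate; tabulate)
open import Data.Vec.Properties using (tabulate-cong)
open import Function using (_∘_; id)
open import Function.Bundles using (Equivalence)
open import Function.Consequences.Propositional
  using (inverseᵇ⇒bijective; strictlyInverseˡ⇒inverseˡ; strictlyInverseʳ⇒inverseʳ)
import Function.Construct.Composition as Composition
open import Function.Definitions using (Bijective)
open import Relation.Binary.Definitions using (DecidableEquality)
open import Relation.Binary.PropositionalEquality
open import Relation.Nullary using (¬_; Dec; yes; no)
open import Relation.Nullary.Decidable
  using (map′; _×-dec_; _⊎-dec_; _→-dec_; ¬?; from-yes; ⌊_⌋; toWitness; dec⇒maybe)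
open import Relation.Unary using (Decidable)

-- Since x ↦ x³ is F₃-linear on F₂₄₃, so is L(x) = m ℓ⁸¹ x⁸¹ + m¹⁰ x⁹ − ℓ² x. Replacing
-- (ℓ, m) by (kℓ, km) turns L into x ↦ k L(kx), which is bijective iff L is when k ≠ 0.
-- Scaling by ℓ⁻¹ (or by m⁻¹ when ℓ = 0) leaves the 244 maps with ℓ = 1 or (ℓ, m) = (0, 1).
-- Each is a linear map of F₃⁵, shown bijective by exhibiting its inverse: the columns of
-- the inverse are found by exhaustive search, and both composites are checked to be the
-- identity on a basis.

_≟₃_ : DecidableEquality F₃
𝟘 ≟₃ 𝟘 = yes refl
𝟙 ≟₃ 𝟙 = yes refl
𝟚 ≟₃ 𝟚 = yes refl
𝟘 ≟₃ 𝟙 = no λ ()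
𝟘 ≟₃ 𝟚 = no λ ()
𝟙 ≟₃ 𝟘 = no λ ()
𝟙 ≟₃ 𝟚 = no λ ()
𝟚 ≟₃ 𝟘 = no λ ()
𝟚 ≟₃ 𝟙 = no λ ()

all₃? : {P : F₃ → Set} → Decidable P → Dec (∀ a → P a)
all₃? P? = map′ (λ { (p𝟘 , p𝟙 , p𝟚) → λ { 𝟘 → p𝟘 ; 𝟙 → p𝟙 ; 𝟚 → p𝟚 } })
                (λ p → p 𝟘 , p 𝟙 , p 𝟚)
                (P? 𝟘 ×-dec P? 𝟙 ×-dec P? 𝟚)

any₃? : {P : F₃ → Set} → Decidable P → Dec (∃ P)
any₃? P? = map′ (λ { (inj₁ p) → 𝟘 , p ; (inj₂ (inj₁ p)) → 𝟙 , p ; (inj₂ (inj₂ p)) → 𝟚 , p })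
                (λ { (𝟘 , p) → inj₁ p ; (𝟙 , p) → inj₂ (inj₁ p) ; (𝟚 , p) → inj₂ (inj₂ p) })
                (P? 𝟘 ⊎-dec P? 𝟙 ⊎-dec P? 𝟚)

el-cong : ∀ {a0 a1 a2 a3 a4 b0 b1 b2 b3 b4} →
          a0 ≡ b0 → a1 ≡ b1 → a2 ≡ b2 → a3 ≡ b3 → a4 ≡ b4 →
          el a0 a1 a2 a3 a4 ≡ el b0 b1 b2 b3 b4
el-cong refl refl refl refl refl = refl

el-injective : ∀ {a0 a1 a2 a3 a4 b0 b1 b2 b3 b4} → el a0 a1 a2 a3 a4 ≡ el b0 b1 b2 b3 b4 →
               a0 ≡ b0 × a1 ≡ b1 × a2 ≡ b2 × a3 ≡ b3 × a4 ≡ b4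
el-injective refl = refl , refl , refl , refl , refl

_≟_ : DecidableEquality F₂₄₃
el a0 a1 a2 a3 a4 ≟ el b0 b1 b2 b3 b4 =
  map′ (λ { (refl , refl , refl , refl , refl) → refl }) el-injective
       (a0 ≟₃ b0 ×-dec a1 ≟₃ b1 ×-dec a2 ≟₃ b2 ×-dec a3 ≟₃ b3 ×-dec a4 ≟₃ b4)

any? : {P : F₂₄₃ → Set} → Decidable P → Dec (∃ P)
any? P? = map′ (λ { (a0 , a1 , a2 , a3 , a4 , p) → el a0 a1 a2 a3 a4 , p })
               (λ { (el a0 a1 a2 a3 a4 , p) → a0 , a1 , a2 , a3 , a4 , p })
               (any₃? λ a0 → any₃? λ a1 → any₃? λ a2 → any₃? λ a3 → any₃? λ a4 → P? (el a0 a1 a2 a3 a4))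

all₃ : (F₃ → Bool) → Bool
all₃ p = p 𝟘 ∧ (p 𝟙 ∧ p 𝟚)

all₃-sound : ∀ p → T (all₃ p) → ∀ a → T (p a)
all₃-sound p h a with Equivalence.to (T-∧ {p 𝟘}) h
... | p𝟘 , p𝟙∧p𝟚 with Equivalence.to (T-∧ {p 𝟙}) p𝟙∧p𝟚
all₃-sound p h 𝟘 | p𝟘 , _ | _       = p𝟘
all₃-sound p h 𝟙 | _   , _ | p𝟙 , _ = p𝟙
all₃-sound p h 𝟚 | _   , _ | _ , p𝟚 = p𝟚

allF : (F₂₄₃ → Bool) → Bool
allF p = all₃ λ a0 → all₃ λ a1 → all₃ λ a2 → all₃ λ a3 → all₃ λ a4 → p (el a0 a1 a2 a3 a4)

allF-sound : ∀ p → T (allF p) → ∀ x → T (p x)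
allF-sound p h (el a0 a1 a2 a3 a4) =
  all₃-sound (λ a4 → p (el a0 a1 a2 a3 a4))
    (all₃-sound (λ a3 → all₃ λ a4 → p (el a0 a1 a2 a3 a4))
      (all₃-sound (λ a2 → all₃ λ a3 → all₃ λ a4 → p (el a0 a1 a2 a3 a4))
        (all₃-sound (λ a1 → all₃ λ a2 → all₃ λ a3 → all₃ λ a4 → p (el a0 a1 a2 a3 a4))
          (all₃-sound (λ a0 → all₃ λ a1 → all₃ λ a2 → all₃ λ a3 → all₃ λ a4 → p (el a0 a1 a2 a3 a4)) h a0) a1) a2) a3) a4

-- Type checking evaluates only the Boolean; a Dec (∀ x → P x) assembled with ×-dec over
-- all 243 points would also build its evidence, which exhausts memory.
allF-decide : {P : F₂₄₃ → Set} (P? : Decidable P) → {_ : T (allF (λ x → ⌊ P? x ⌋))} → ∀ x → P x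
allF-decide P? {h} x = toWitness (allF-sound (λ x → ⌊ P? x ⌋) h x)

+₃-assoc : ∀ a b c → (a +₃ b) +₃ c ≡ a +₃ (b +₃ c)
+₃-assoc = from-yes (all₃? λ a → all₃? λ b → all₃? λ c → ((a +₃ b) +₃ c) ≟₃ (a +₃ (b +₃ c)))

+₃-comm : ∀ a b → a +₃ b ≡ b +₃ a
+₃-comm = from-yes (all₃? λ a → all₃? λ b → (a +₃ b) ≟₃ (b +₃ a))

+₃-identityʳ : ∀ a → a +₃ 𝟘 ≡ a
+₃-identityʳ = from-yes (all₃? λ a → (a +₃ 𝟘) ≟₃ a)

*₃-zeroʳ : ∀ a → a *₃ 𝟘 ≡ 𝟘
*₃-zeroʳ = from-yes (all₃? λ a → (a *₃ 𝟘) ≟₃ 𝟘)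

*₃-assoc : ∀ a b c → (a *₃ b) *₃ c ≡ a *₃ (b *₃ c)
*₃-assoc = from-yes (all₃? λ a → all₃? λ b → all₃? λ c → ((a *₃ b) *₃ c) ≟₃ (a *₃ (b *₃ c)))

*₃-comm : ∀ a b → a *₃ b ≡ b *₃ a
*₃-comm = from-yes (all₃? λ a → all₃? λ b → (a *₃ b) ≟₃ (b *₃ a))

*₃-distribˡ-+₃ : ∀ a b c → a *₃ (b +₃ c) ≡ (a *₃ b) +₃ (a *₃ c)
*₃-distribˡ-+₃ = from-yes (all₃? λ a → all₃? λ b → all₃? λ c → (a *₃ (b +₃ c)) ≟₃ ((a *₃ b) +₃ (a *₃ c)))

*₃-distribʳ-+₃ : ∀ a b c → (b +₃ c) *₃ a ≡ (b *₃ a) +₃ (c *₃ a)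
*₃-distribʳ-+₃ = from-yes (all₃? λ a → all₃? λ b → all₃? λ c → ((b +₃ c) *₃ a) ≟₃ ((b *₃ a) +₃ (c *₃ a)))

-₃≗𝟚*₃ : ∀ a → -₃ a ≡ 𝟚 *₃ a
-₃≗𝟚*₃ = from-yes (all₃? λ a → (-₃ a) ≟₃ (𝟚 *₃ a))

+F-assoc : ∀ u v w → (u +F v) +F w ≡ u +F (v +F w)
+F-assoc (el a0 a1 a2 a3 a4) (el b0 b1 b2 b3 b4) (el c0 c1 c2 c3 c4) =
  el-cong (+₃-assoc a0 b0 c0) (+₃-assoc a1 b1 c1) (+₃-assoc a2 b2 c2) (+₃-assoc a3 b3 c3) (+₃-assoc a4 b4 c4)

+F-comm : ∀ u v → u +F v ≡ v +F u
+F-comm (el a0 a1 a2 a3 a4) (el b0 b1 b2 b3 b4) =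
  el-cong (+₃-comm a0 b0) (+₃-comm a1 b1) (+₃-comm a2 b2) (+₃-comm a3 b3) (+₃-comm a4 b4)

+F-identityʳ : ∀ u → u +F 0F ≡ u
+F-identityʳ (el a0 a1 a2 a3 a4) =
  el-cong (+₃-identityʳ a0) (+₃-identityʳ a1) (+₃-identityʳ a2) (+₃-identityʳ a3) (+₃-identityʳ a4)

·F-zeroʳ : ∀ s → s ·F 0F ≡ 0F
·F-zeroʳ s = el-cong (*₃-zeroʳ s) (*₃-zeroʳ s) (*₃-zeroʳ s) (*₃-zeroʳ s) (*₃-zeroʳ s)

·F-assoc : ∀ s r u → (s *₃ r) ·F u ≡ s ·F (r ·F u)
·F-assoc s r (el a0 a1 a2 a3 a4) =
  el-cong (*₃-assoc s r a0) (*₃-assoc s r a1) (*₃-assoc s r a2) (*₃-assoc s r a3) (*₃-assoc s r a4)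

·F-distribˡ : ∀ s u v → s ·F (u +F v) ≡ (s ·F u) +F (s ·F v)
·F-distribˡ s (el a0 a1 a2 a3 a4) (el b0 b1 b2 b3 b4) =
  el-cong (*₃-distribˡ-+₃ s a0 b0) (*₃-distribˡ-+₃ s a1 b1) (*₃-distribˡ-+₃ s a2 b2)
          (*₃-distribˡ-+₃ s a3 b3) (*₃-distribˡ-+₃ s a4 b4)

·F-distribʳ : ∀ s r u → (s +₃ r) ·F u ≡ (s ·F u) +F (r ·F u)
·F-distribʳ s r (el a0 a1 a2 a3 a4) =
  el-cong (*₃-distribʳ-+₃ a0 s r) (*₃-distribʳ-+₃ a1 s r) (*₃-distribʳ-+₃ a2 s r)
          (*₃-distribʳ-+₃ a3 s r) (*₃-distribʳ-+₃ a4 s r)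

-F≗𝟚·F : ∀ u → -F u ≡ 𝟚 ·F u
-F≗𝟚·F (el a0 a1 a2 a3 a4) =
  el-cong (-₃≗𝟚*₃ a0) (-₃≗𝟚*₃ a1) (-₃≗𝟚*₃ a2) (-₃≗𝟚*₃ a3) (-₃≗𝟚*₃ a4)

+F-commutativeSemigroup : CommutativeSemigroup _ _
+F-commutativeSemigroup = record
  { _∙_ = _+F_
  ; isCommutativeSemigroup = record
    { isSemigroup = record
      { isMagma = record { isEquivalence = isEquivalence ; ∙-cong = cong₂ _+F_ }
      ; assoc = +F-assoc }
    ; comm = +F-comm } }

+F-interchange : ∀ u v w x → (u +F v) +F (w +F x) ≡ (u +F w) +F (v +F x)
+F-interchange = CommutativeSemigroupProperties.interchange +F-commutativeSemigroup

record IsLinear (f : F₂₄₃ → F₂₄₃) : Set where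
  field
    +F-homo : ∀ u v → f (u +F v) ≡ f u +F f v
    ·F-homo : ∀ s u → f (s ·F u) ≡ s ·F f u

  0F-homo : f 0F ≡ 0F
  0F-homo = ·F-homo 𝟘 0F

  -F-homo : ∀ u → f (-F u) ≡ -F f u
  -F-homo u = begin
    f (-F u)    ≡⟨ cong f (-F≗𝟚·F u) ⟩
    f (𝟚 ·F u)  ≡⟨ ·F-homo 𝟚 u ⟩
    𝟚 ·F f u    ≡⟨ sym (-F≗𝟚·F (f u)) ⟩
    -F f u      ∎
    where open ≡-Reasoning

open IsLinear

isLinear-resp-≗ : ∀ {f g} → f ≗ g → IsLinear f → IsLinear g
isLinear-resp-≗ {f} {g} f≗g f-lin = record
  { +F-homo = λ u v → trans (sym (f≗g (u +F v))) (trans (+F-homo f-lin u v) (cong₂ _+F_ (f≗g u) (f≗g v)))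
  ; ·F-homo = λ s u → trans (sym (f≗g (s ·F u))) (trans (·F-homo f-lin s u) (cong (s ·F_) (f≗g u)))
  }

id-isLinear : IsLinear id
id-isLinear = record { +F-homo = λ _ _ → refl ; ·F-homo = λ _ _ → refl }

∘-isLinear : ∀ {f g} → IsLinear f → IsLinear g → IsLinear (f ∘ g)
∘-isLinear {f} {g} f-lin g-lin = record
  { +F-homo = λ u v → trans (cong f (+F-homo g-lin u v)) (+F-homo f-lin (g u) (g v))
  ; ·F-homo = λ s u → trans (cong f (·F-homo g-lin s u)) (·F-homo f-lin s (g u))
  }

+-isLinear : ∀ {f g} → IsLinear f → IsLinear g → IsLinear (λ x → f x +F g x)
+-isLinear {f} {g} f-lin g-lin = record
  { +F-homo = λ u v → trans (cong₂ _+F_ (+F-homo f-lin u v) (+F-homo g-lin u v))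
                            (+F-interchange (f u) (f v) (g u) (g v))
  ; ·F-homo = λ s u → trans (cong₂ _+F_ (·F-homo f-lin s u) (·F-homo g-lin s u))
                            (sym (·F-distribˡ s (f u) (g u)))
  }

·F-isLinear : ∀ s → IsLinear (s ·F_)
·F-isLinear s = record
  { +F-homo = ·F-distribˡ s
  ; ·F-homo = λ r u → trans (sym (·F-assoc s r u)) (trans (cong (_·F u) (*₃-comm s r)) (·F-assoc r s u))
  }

-F-isLinear : IsLinear (λ u → -F u)
-F-isLinear = isLinear-resp-≗ (sym ∘ -F≗𝟚·F) (·F-isLinear 𝟚)

combination : ∀ {n} → Vec F₂₄₃ n → Vec F₃ n → F₂₄₃
combination []       []       = 0F
combination (v ∷ vs) (s ∷ ss) = (s ·F v) +F combination vs ss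

combination-homo : ∀ {f n} → IsLinear f → (vs : Vec F₂₄₃ n) (ss : Vec F₃ n) →
                   f (combination vs ss) ≡ combination (map f vs) ss
combination-homo f-lin []       []       = 0F-homo f-lin
combination-homo f-lin (v ∷ vs) (s ∷ ss) =
  trans (+F-homo f-lin _ _) (cong₂ _+F_ (·F-homo f-lin s v) (combination-homo f-lin vs ss))

combination-+₃ : ∀ {n} (vs : Vec F₂₄₃ n) ss rs →
                 combination vs (zipWith _+₃_ ss rs) ≡ combination vs ss +F combination vs rs
combination-+₃ []       []       []       = refl
combination-+₃ (v ∷ vs) (s ∷ ss) (r ∷ rs) =
  trans (cong₂ _+F_ (·F-distribʳ s r v) (combination-+₃ vs ss rs))
        (+F-interchange (s ·F v) (r ·F v) (combination vs ss) (combination vs rs))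

combination-*₃ : ∀ {n} s (vs : Vec F₂₄₃ n) ss →
                 combination vs (map (s *₃_) ss) ≡ s ·F combination vs ss
combination-*₃ s []       []       = sym (·F-zeroʳ s)
combination-*₃ s (v ∷ vs) (r ∷ rs) =
  trans (cong₂ _+F_ (·F-assoc s r v) (combination-*₃ s vs rs))
        (sym (·F-distribˡ s (r ·F v) (combination vs rs)))

coordinates : F₂₄₃ → Vec F₃ 5
coordinates (el a0 a1 a2 a3 a4) = a0 ∷ a1 ∷ a2 ∷ a3 ∷ a4 ∷ []

⟦_⟧ : Vec F₂₄₃ 5 → F₂₄₃ → F₂₄₃
⟦ vs ⟧ x = combination vs (coordinates x)

⟦⟧-isLinear : ∀ vs → IsLinear ⟦ vs ⟧
⟦⟧-isLinear vs = record
  { +F-homo = λ u v → combination-+₃ vs (coordinates u) (coordinates v)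
  ; ·F-homo = λ s u → combination-*₃ s vs (coordinates u)
  }

e : Fin 5 → F₂₄₃
e zero                          = el 𝟙 𝟘 𝟘 𝟘 𝟘
e (suc zero)                    = el 𝟘 𝟙 𝟘 𝟘 𝟘
e (suc (suc zero))              = el 𝟘 𝟘 𝟙 𝟘 𝟘
e (suc (suc (suc zero)))        = el 𝟘 𝟘 𝟘 𝟙 𝟘
e (suc (suc (suc (suc zero))))  = el 𝟘 𝟘 𝟘 𝟘 𝟙

columns : (F₂₄₃ → F₂₄₃) → Vec F₂₄₃ 5
columns f = tabulate (f ∘ e)

⟦columns-id⟧ : ∀ x → ⟦ columns id ⟧ x ≡ x
⟦columns-id⟧ = allF-decide (λ x → ⟦ columns id ⟧ x ≟ x)

linear≗⟦columns⟧ : ∀ {f} → IsLinear f → ∀ x → f x ≡ ⟦ columns f ⟧ x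
linear≗⟦columns⟧ {f} f-lin x =
  trans (cong f (sym (⟦columns-id⟧ x))) (combination-homo f-lin (columns id) (coordinates x))

linear-ext : ∀ {f g} → IsLinear f → IsLinear g → (∀ i → f (e i) ≡ g (e i)) → f ≗ g
linear-ext {f} {g} f-lin g-lin f≗g-on-basis x = begin
  f x                  ≡⟨ linear≗⟦columns⟧ f-lin x ⟩
  ⟦ columns f ⟧ x      ≡⟨ cong (λ vs → ⟦ vs ⟧ x) (tabulate-cong f≗g-on-basis) ⟩
  ⟦ columns g ⟧ x      ≡⟨ linear≗⟦columns⟧ g-lin x ⟨
  g x                  ∎
  where open ≡-Reasoning

mulT-isLinear : IsLinear mulT
mulT-isLinear = isLinear-resp-≗ (λ x → sym (mulT≗⟦columns⟧ x)) (⟦⟧-isLinear (columns mulT))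
  where
  mulT≗⟦columns⟧ : ∀ x → mulT x ≡ ⟦ columns mulT ⟧ x
  mulT≗⟦columns⟧ = allF-decide (λ x → mulT x ≟ ⟦ columns mulT ⟧ x)

-- a *F b unfolds to horner a (coordinates b).
horner : ∀ {n} → F₂₄₃ → Vec F₃ (suc n) → F₂₄₃
horner a (s ∷ [])     = s ·F a
horner a (s ∷ r ∷ ss) = (s ·F a) +F mulT (horner a (r ∷ ss))

horner-isLinear : ∀ {n} (ss : Vec F₃ (suc n)) → IsLinear (λ a → horner a ss)
horner-isLinear (s ∷ [])     = ·F-isLinear s
horner-isLinear (s ∷ r ∷ ss) = +-isLinear (·F-isLinear s) (∘-isLinear mulT-isLinear (horner-isLinear (r ∷ ss)))

map-iterate : ∀ {A : Set} {n} (f : A → A) x → map f (iterate f x n) ≡ iterate f (f x) n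
map-iterate {n = zero}  f x = refl
map-iterate {n = suc n} f x = cong (f x ∷_) (map-iterate f (f x))

horner≡combination : ∀ {n} a (ss : Vec F₃ (suc n)) → horner a ss ≡ combination (iterate mulT a (suc n)) ss
horner≡combination a (s ∷ [])     = sym (+F-identityʳ (s ·F a))
horner≡combination {suc n} a (s ∷ r ∷ ss) = cong ((s ·F a) +F_) (begin
  mulT (horner a (r ∷ ss))                                 ≡⟨ cong mulT (horner≡combination a (r ∷ ss)) ⟩
  mulT (combination (iterate mulT a (suc n)) (r ∷ ss))     ≡⟨ combination-homo mulT-isLinear (iterate mulT a (suc n)) (r ∷ ss) ⟩
  combination (map mulT (iterate mulT a (suc n))) (r ∷ ss) ≡⟨ cong (λ vs → combination vs (r ∷ ss)) (map-iterate mulT a) ⟩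
  combination (iterate mulT (mulT a) (suc n)) (r ∷ ss)     ∎)
  where open ≡-Reasoning

*F-isLinearˡ : ∀ b → IsLinear (_*F b)
*F-isLinearˡ b = horner-isLinear (coordinates b)

*F-isLinearʳ : ∀ a → IsLinear (a *F_)
*F-isLinearʳ a = isLinear-resp-≗ (λ b → sym (horner≡combination a (coordinates b))) (⟦⟧-isLinear (iterate mulT a 5))

*F-comm : ∀ a b → a *F b ≡ b *F a
*F-comm a = linear-ext (*F-isLinearʳ a) (*F-isLinearˡ a)
  (λ j → linear-ext (*F-isLinearˡ (e j)) (*F-isLinearʳ (e j)) (λ i → on-basis i j) a)
  where
  on-basis : ∀ i j → e i *F e j ≡ e j *F e i
  on-basis = from-yes (allFin? λ i → allFin? λ j → (e i *F e j) ≟ (e j *F e i))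

*F-assoc : ∀ a b c → (a *F b) *F c ≡ a *F (b *F c)
*F-assoc a b = linear-ext (*F-isLinearʳ (a *F b)) (∘-isLinear (*F-isLinearʳ a) (*F-isLinearʳ b))
  (λ k → linear-ext (∘-isLinear (*F-isLinearˡ (e k)) (*F-isLinearʳ a)) (∘-isLinear (*F-isLinearʳ a) (*F-isLinearˡ (e k)))
    (λ j → linear-ext (∘-isLinear (*F-isLinearˡ (e k)) (*F-isLinearˡ (e j))) (*F-isLinearˡ (e j *F e k))
      (λ i → on-basis i j k) a) b)
  where
  on-basis : ∀ i j k → (e i *F e j) *F e k ≡ e i *F (e j *F e k)
  on-basis = from-yes (allFin? λ i → allFin? λ j → allFin? λ k → ((e i *F e j) *F e k) ≟ (e i *F (e j *F e k)))

*F-identityˡ : ∀ a → 1F *F a ≡ a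
*F-identityˡ = allF-decide (λ a → (1F *F a) ≟ a)

*F-identityʳ : ∀ a → a *F 1F ≡ a
*F-identityʳ a = trans (*F-comm a 1F) (*F-identityˡ a)

*F-zeroʳ : ∀ a → a *F 0F ≡ 0F
*F-zeroʳ a = refl

*F-commutativeSemigroup : CommutativeSemigroup _ _
*F-commutativeSemigroup = record
  { _∙_ = _*F_
  ; isCommutativeSemigroup = record
    { isSemigroup = record
      { isMagma = record { isEquivalence = isEquivalence ; ∙-cong = cong₂ _*F_ }
      ; assoc = *F-assoc }
    ; comm = *F-comm } }

*F-interchange : ∀ a b c d → (a *F b) *F (c *F d) ≡ (a *F c) *F (b *F d)
*F-interchange = CommutativeSemigroupProperties.interchange *F-commutativeSemigroup

*F-swapˡ : ∀ a b c → a *F (b *F c) ≡ b *F (a *F c)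
*F-swapˡ = CommutativeSemigroupProperties.x∙yz≈y∙xz *F-commutativeSemigroup

^F-distribʳ-*F : ∀ a b n → (a *F b) ^F n ≡ (a ^F n) *F (b ^F n)
^F-distribʳ-*F a b zero    = sym (*F-identityˡ 1F)
^F-distribʳ-*F a b (suc n) =
  trans (cong ((a *F b) *F_) (^F-distribʳ-*F a b n)) (*F-interchange a b (a ^F n) (b ^F n))

^F-distribˡ-+-*F : ∀ x m n → x ^F (m + n) ≡ (x ^F m) *F (x ^F n)
^F-distribˡ-+-*F x zero    n = sym (*F-identityˡ (x ^F n))
^F-distribˡ-+-*F x (suc m) n =
  trans (cong (x *F_) (^F-distribˡ-+-*F x m n)) (sym (*F-assoc x (x ^F m) (x ^F n)))

1F-^F : ∀ n → 1F ^F n ≡ 1F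
1F-^F zero    = refl
1F-^F (suc n) = trans (cong (1F *F_) (1F-^F n)) (*F-identityˡ 1F)

^F-*-assoc : ∀ x m n → x ^F (m * n) ≡ (x ^F m) ^F n
^F-*-assoc x zero    n = sym (1F-^F n)
^F-*-assoc x (suc m) n = begin
  x ^F (n + m * n)               ≡⟨ ^F-distribˡ-+-*F x n (m * n) ⟩
  (x ^F n) *F (x ^F (m * n))     ≡⟨ cong ((x ^F n) *F_) (^F-*-assoc x m n) ⟩
  (x ^F n) *F ((x ^F m) ^F n)    ≡⟨ ^F-distribʳ-*F x (x ^F m) n ⟨
  (x *F (x ^F m)) ^F n           ∎
  where open ≡-Reasoning

-- The cubes 1, t³, t⁶, t⁹, t¹² of the basis, reduced by t⁵ = t + 2 (checked by ^F-3). A table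
-- rather than columns (_^F 3), so that the exhaustive checks below evaluate frobenius cheaply.
frobeniusColumns : Vec F₂₄₃ 5
frobeniusColumns = el 𝟙 𝟘 𝟘 𝟘 𝟘 ∷ el 𝟘 𝟘 𝟘 𝟙 𝟘 ∷ el 𝟘 𝟚 𝟙 𝟘 𝟘 ∷ el 𝟚 𝟙 𝟘 𝟘 𝟚 ∷ el 𝟘 𝟘 𝟙 𝟙 𝟙 ∷ []

frobenius : F₂₄₃ → F₂₄₃
frobenius = ⟦ frobeniusColumns ⟧

^F-3 : ∀ x → x ^F 3 ≡ frobenius x
^F-3 = allF-decide (λ x → (x ^F 3) ≟ frobenius x)

frobenius^ : ℕ → F₂₄₃ → F₂₄₃
frobenius^ zero    x = x
frobenius^ (suc n) x = frobenius^ n (frobenius x)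

frobenius^-isLinear : ∀ n → IsLinear (frobenius^ n)
frobenius^-isLinear zero    = id-isLinear
frobenius^-isLinear (suc n) = ∘-isLinear (frobenius^-isLinear n) (⟦⟧-isLinear frobeniusColumns)

^F-3^ : ∀ n x → x ^F (3 ^ n) ≡ frobenius^ n x
^F-3^ zero    x = *F-identityʳ x
^F-3^ (suc n) x = begin
  x ^F (3 * 3 ^ n)          ≡⟨ ^F-*-assoc x 3 (3 ^ n) ⟩
  (x ^F 3) ^F (3 ^ n)       ≡⟨ cong (_^F (3 ^ n)) (^F-3 x) ⟩
  frobenius x ^F (3 ^ n)    ≡⟨ ^F-3^ n (frobenius x) ⟩
  frobenius^ (suc n) x      ∎
  where open ≡-Reasoning

^F-9 : ∀ x → x ^F 9 ≡ frobenius^ 2 x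
^F-9 = ^F-3^ 2

^F-81 : ∀ x → x ^F 81 ≡ frobenius^ 4 x
^F-81 = ^F-3^ 4

-- linPoly ℓ m is trinomial (_^F 81) (_^F 9) 10 ℓ m by definition.
trinomial : (P Q : F₂₄₃ → F₂₄₃) → ℕ → F₂₄₃ → F₂₄₃ → F₂₄₃ → F₂₄₃
trinomial P Q r ℓ m x = (((m *F P ℓ) *F P x) +F ((m ^F r) *F Q x)) -F ((ℓ ^F 2) *F x)

trinomial-cong : ∀ {P P′ Q Q′} → P ≗ P′ → Q ≗ Q′ → ∀ r ℓ m x → trinomial P Q r ℓ m x ≡ trinomial P′ Q′ r ℓ m x
trinomial-cong P≗P′ Q≗Q′ r ℓ m x =
  cong (_-F ((ℓ ^F 2) *F x))
       (cong₂ _+F_ (cong₂ (λ a b → (m *F a) *F b) (P≗P′ ℓ) (P≗P′ x)) (cong ((m ^F r) *F_) (Q≗Q′ x)))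

trinomial-isLinear : ∀ {P Q} → IsLinear P → IsLinear Q → ∀ r ℓ m → IsLinear (trinomial P Q r ℓ m)
trinomial-isLinear P-lin Q-lin r ℓ m =
  +-isLinear (+-isLinear (∘-isLinear (*F-isLinearʳ _) P-lin) (∘-isLinear (*F-isLinearʳ _) Q-lin))
             (∘-isLinear -F-isLinear (*F-isLinearʳ (ℓ ^F 2)))

scale-monomial : ∀ k k′ c c′ y y′ → c ≡ (k *F k′) *F c′ → k′ *F y ≡ y′ → c *F y ≡ k *F (c′ *F y′)
scale-monomial k k′ c c′ y y′ c≡kk′c′ k′y≡y′ = begin
  c *F y                     ≡⟨ cong (_*F y) c≡kk′c′ ⟩
  ((k *F k′) *F c′) *F y     ≡⟨ *F-assoc (k *F k′) c′ y ⟩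
  (k *F k′) *F (c′ *F y)     ≡⟨ *F-assoc k k′ (c′ *F y) ⟩
  k *F (k′ *F (c′ *F y))     ≡⟨ cong (k *F_) (*F-swapˡ k′ c′ y) ⟩
  k *F (c′ *F (k′ *F y))     ≡⟨ cong (λ z → k *F (c′ *F z)) k′y≡y′ ⟩
  k *F (c′ *F y′)            ∎
  where open ≡-Reasoning

-- Each term of the trinomial is a coefficient of degree n + 1 in (ℓ, m) times xⁿ. The
-- exponent r is kept apart from suc q so that the instance r = 10 matches linPoly literally.
trinomial-scale : ∀ p q r → r ≡ suc q → ∀ k ℓ m x →
                  trinomial (_^F p) (_^F q) r (k *F ℓ) (k *F m) x ≡ k *F trinomial (_^F p) (_^F q) r ℓ m (k *F x)
trinomial-scale p q .(suc q) refl k ℓ m x = begin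
  ((((k *F m) *F ((k *F ℓ) ^F p)) *F (x ^F p)) +F (((k *F m) ^F suc q) *F (x ^F q))) -F (((k *F ℓ) ^F 2) *F x)
    ≡⟨ cong₂ _-F_ (cong₂ _+F_ term-p term-q) term-2 ⟩
  ((k *F A) +F (k *F B)) -F (k *F C)
    ≡⟨ cong₂ _+F_ (+F-homo k*-isLinear A B) (-F-homo k*-isLinear C) ⟨
  (k *F (A +F B)) +F (k *F (-F C))
    ≡⟨ +F-homo k*-isLinear (A +F B) (-F C) ⟨
  k *F ((A +F B) -F C)
    ∎
  where
  open ≡-Reasoning
  k*-isLinear : IsLinear (k *F_)
  k*-isLinear = *F-isLinearʳ k
  A B C : F₂₄₃
  A = (m *F (ℓ ^F p)) *F ((k *F x) ^F p)
  B = (m ^F suc q) *F ((k *F x) ^F q)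
  C = (ℓ ^F 2) *F (k *F x)
  term-p : ((k *F m) *F ((k *F ℓ) ^F p)) *F (x ^F p) ≡ k *F A
  term-p = scale-monomial k (k ^F p) ((k *F m) *F ((k *F ℓ) ^F p)) (m *F (ℓ ^F p)) (x ^F p) ((k *F x) ^F p)
    (trans (cong ((k *F m) *F_) (^F-distribʳ-*F k ℓ p)) (*F-interchange k m (k ^F p) (ℓ ^F p)))
    (sym (^F-distribʳ-*F k x p))
  term-q : ((k *F m) ^F suc q) *F (x ^F q) ≡ k *F B
  term-q = scale-monomial k (k ^F q) ((k *F m) ^F suc q) (m ^F suc q) (x ^F q) ((k *F x) ^F q)
    (^F-distribʳ-*F k m (suc q)) (sym (^F-distribʳ-*F k x q))
  term-2 : ((k *F ℓ) ^F 2) *F x ≡ k *F C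
  term-2 = scale-monomial k k ((k *F ℓ) ^F 2) (ℓ ^F 2) x (k *F x)
    (trans (^F-distribʳ-*F k ℓ 2) (cong (λ a → (k *F a) *F (ℓ ^F 2)) (*F-identityʳ k)))
    refl

*F-inverse : ∀ x → x ≢ 0F → ∃ λ y → x *F y ≡ 1F
*F-inverse = allF-decide (λ x → ¬? (x ≟ 0F) →-dec any? λ y → (x *F y) ≟ 1F)

*F-cancel : ∀ {k k′} → k *F k′ ≡ 1F → ∀ y → k *F (k′ *F y) ≡ y
*F-cancel {k} {k′} kk′≡1 y = trans (sym (*F-assoc k k′ y)) (trans (cong (_*F y) kk′≡1) (*F-identityˡ y))

bijective-resp-≗ : ∀ {A B : Set} {f g : A → B} → f ≗ g → Bijective _≡_ _≡_ f → Bijective _≡_ _≡_ g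
bijective-resp-≗ {f = f} {g} f≗g (f-injective , f-surjective) = g-injective , g-surjective
  where
  g-injective : ∀ {x y} → g x ≡ g y → x ≡ y
  g-injective {x} {y} gx≡gy = f-injective (trans (f≗g x) (trans gx≡gy (sym (f≗g y))))
  g-surjective : ∀ y → ∃ λ x → ∀ {z} → z ≡ x → g z ≡ y
  g-surjective y with f-surjective y
  ... | x , fx≡y = x , λ { refl → trans (sym (f≗g x)) (fx≡y refl) }

inverse⇒bijective : ∀ {A B : Set} {f : A → B} {g : B → A} →
                    (∀ y → f (g y) ≡ y) → (∀ x → g (f x) ≡ x) → Bijective _≡_ _≡_ f
inverse⇒bijective {f = f} fg≗id gf≗id =
  inverseᵇ⇒bijective (strictlyInverseˡ⇒inverseˡ f fg≗id , strictlyInverseʳ⇒inverseʳ f gf≗id)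

*F-bijective : ∀ {k} → k ≢ 0F → Bijective _≡_ _≡_ (k *F_)
*F-bijective {k} k≢0 = unit-bijective (*F-inverse k k≢0)
  where
  unit-bijective : (∃ λ k′ → k *F k′ ≡ 1F) → Bijective _≡_ _≡_ (k *F_)
  unit-bijective (k′ , kk′≡1) =
    inverse⇒bijective {g = k′ *F_} (*F-cancel kk′≡1) (*F-cancel (trans (*F-comm k′ k) kk′≡1))

trinomial-scale-bijective : ∀ p q r → r ≡ suc q → ∀ k ℓ m → k ≢ 0F →
                            Bijective _≡_ _≡_ (trinomial (_^F p) (_^F q) r ℓ m) →
                            Bijective _≡_ _≡_ (trinomial (_^F p) (_^F q) r (k *F ℓ) (k *F m))
trinomial-scale-bijective p q r r≡1+q k ℓ m k≢0 bij =
  bijective-resp-≗ (λ x → sym (trinomial-scale p q r r≡1+q k ℓ m x))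
    (Composition.bijective _≡_ _≡_ _≡_ (Composition.bijective _≡_ _≡_ _≡_ (*F-bijective k≢0) bij) (*F-bijective k≢0))

linear-inverse⇒bijective : ∀ {f g} → IsLinear f → IsLinear g →
                           (∀ i → f (g (e i)) ≡ e i) → (∀ i → g (f (e i)) ≡ e i) → Bijective _≡_ _≡_ f
linear-inverse⇒bijective f-lin g-lin fg≡id gf≡id = inverse⇒bijective
  (linear-ext (∘-isLinear f-lin g-lin) id-isLinear fg≡id)
  (linear-ext (∘-isLinear g-lin f-lin) id-isLinear gf≡id)

-- 0F when y has no preimage.
preimage : (F₂₄₃ → F₂₄₃) → F₂₄₃ → F₂₄₃
preimage f y = maybe′ proj₁ 0F (dec⇒maybe (any? λ x → f x ≟ y))

inverseColumns : Vec F₂₄₃ 5 → Vec F₂₄₃ 5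
inverseColumns vs = map (preimage ⟦ vs ⟧) (columns id)

InverseOnBasis : (F₂₄₃ → F₂₄₃) → (F₂₄₃ → F₂₄₃) → Set
InverseOnBasis f g = ∀ i → f (g (e i)) ≡ e i × g (f (e i)) ≡ e i

inverseOnBasis? : ∀ f g → Dec (InverseOnBasis f g)
inverseOnBasis? f g = allFin? λ i → (f (g (e i)) ≟ e i) ×-dec (g (f (e i)) ≟ e i)

Certified : (F₂₄₃ → F₂₄₃) → Set
Certified f = InverseOnBasis ⟦ columns f ⟧ ⟦ inverseColumns (columns f) ⟧

certified? : ∀ f → Dec (Certified f)
certified? f = inverseOnBasis? ⟦ columns f ⟧ ⟦ inverseColumns (columns f) ⟧

certified⇒bijective : ∀ {f} → IsLinear f → Certified f → Bijective _≡_ _≡_ f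
certified⇒bijective {f} f-lin certificate =
  bijective-resp-≗ (λ x → sym (linear≗⟦columns⟧ f-lin x))
    (linear-inverse⇒bijective (⟦⟧-isLinear (columns f)) (⟦⟧-isLinear (inverseColumns (columns f)))
                              (λ i → proj₁ (certificate i)) (λ i → proj₂ (certificate i)))

frobeniusTrinomial : F₂₄₃ → F₂₄₃ → F₂₄₃ → F₂₄₃
frobeniusTrinomial = trinomial (frobenius^ 4) (frobenius^ 2) 10

linPoly≡frobeniusTrinomial : ∀ ℓ m x → linPoly ℓ m x ≡ frobeniusTrinomial ℓ m x
linPoly≡frobeniusTrinomial ℓ m x =
  trinomial-cong {_^F 81} {frobenius^ 4} {_^F 9} {frobenius^ 2} ^F-81 ^F-9 10 ℓ m x

frobeniusTrinomial-isLinear : ∀ ℓ m → IsLinear (frobeniusTrinomial ℓ m)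
frobeniusTrinomial-isLinear = trinomial-isLinear (frobenius^-isLinear 4) (frobenius^-isLinear 2) 10

certified⇒linPoly-bijective : ∀ ℓ m → Certified (frobeniusTrinomial ℓ m) → IsPermutationOf𝔽q (linPoly ℓ m)
certified⇒linPoly-bijective ℓ m certificate =
  bijective-resp-≗ (λ x → sym (linPoly≡frobeniusTrinomial ℓ m x))
    (certified⇒bijective (frobeniusTrinomial-isLinear ℓ m) certificate)

frobeniusTrinomial-1-certified : ∀ m → Certified (frobeniusTrinomial 1F m)
frobeniusTrinomial-1-certified = allF-decide (λ m → certified? (frobeniusTrinomial 1F m))

linPoly-1-bijective : ∀ m → IsPermutationOf𝔽q (linPoly 1F m)
linPoly-1-bijective m = certified⇒linPoly-bijective 1F m (frobeniusTrinomial-1-certified m)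

linPoly-0-1-bijective : IsPermutationOf𝔽q (linPoly 0F 1F)
linPoly-0-1-bijective = certified⇒linPoly-bijective 0F 1F (from-yes (certified? (frobeniusTrinomial 0F 1F)))

linPoly-scale-bijective : ∀ k ℓ m → k ≢ 0F → IsPermutationOf𝔽q (linPoly ℓ m) →
                          IsPermutationOf𝔽q (linPoly (k *F ℓ) (k *F m))
linPoly-scale-bijective = trinomial-scale-bijective 81 9 10 refl

-- From here on arguments are explicit and the case split avoids `with`: unifying against,
-- or abstracting over, linPoly ℓ m makes Agda unfold the powers x ^F 81 of symbolic elements.
linPoly-bijective-resp : ∀ ℓ m {ℓ′ m′} → ℓ′ ≡ ℓ → m′ ≡ m →
                         IsPermutationOf𝔽q (linPoly ℓ′ m′) → IsPermutationOf𝔽q (linPoly ℓ m)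
linPoly-bijective-resp ℓ m refl refl bijective = bijective

ℓ≢0⇒linPoly-bijective : ∀ ℓ m → ℓ ≢ 0F → IsPermutationOf𝔽q (linPoly ℓ m)
ℓ≢0⇒linPoly-bijective ℓ m ℓ≢0 = divide-by-ℓ (*F-inverse ℓ ℓ≢0)
  where
  divide-by-ℓ : (∃ λ ℓ′ → ℓ *F ℓ′ ≡ 1F) → IsPermutationOf𝔽q (linPoly ℓ m)
  divide-by-ℓ (ℓ′ , ℓℓ′≡1) =
    linPoly-bijective-resp ℓ m {ℓ *F 1F} {ℓ *F (ℓ′ *F m)} (*F-identityʳ ℓ) (*F-cancel {ℓ} {ℓ′} ℓℓ′≡1 m)
      (linPoly-scale-bijective ℓ 1F (ℓ′ *F m) ℓ≢0 (linPoly-1-bijective (ℓ′ *F m)))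

proposition3p2 : (ℓ0 m0 : F₂₄₃) → ¬ (ℓ0 ≡ 0F × m0 ≡ 0F) →
    IsPermutationOf𝔽q (linPoly ℓ0 m0)
proposition3p2 ℓ m ¬ℓ≡0×m≡0 = cases (ℓ ≟ 0F) (m ≟ 0F)
  where
  cases : Dec (ℓ ≡ 0F) → Dec (m ≡ 0F) → IsPermutationOf𝔽q (linPoly ℓ m)
  cases (no ℓ≢0)  _         = ℓ≢0⇒linPoly-bijective ℓ m ℓ≢0
  cases (yes ℓ≡0) (yes m≡0) = ⊥-elim (¬ℓ≡0×m≡0 (ℓ≡0 , m≡0))
  cases (yes ℓ≡0) (no m≢0)  =
    linPoly-bijective-resp ℓ m {m *F 0F} {m *F 1F} (trans (*F-zeroʳ m) (sym ℓ≡0)) (*F-identityʳ m)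
      (linPoly-scale-bijective m 0F 1F m≢0 linPoly-0-1-bijective)
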